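{- For all integers $k\ge1$, $\mathrm{rc}(\Delta_{k!})\ge k$, where $\Delta_d=\{\mathbf{0},e_1,\dots,e_d\}\subseteq\{0,1\}^d$ is the vertex set of the standard $d$-simplex.
   Context: For $X\subseteq\mathbb{Z}^d$, a polyhedron $R\subseteq\mathbb{R}^d$ (possibly defined by inequalities with irrational coefficients) is called a relaxation for $X$ if $R\cap\mathbb{Z}^d=\mathrm{conv}(X)\cap\mathbb{Z}^d$. The relaxation complexity $\mathrm{rc}(X)$ is the smallest number of facets of any relaxation for $X$. $e_i$ denotes the $i$-th unit vector. -}

module Defs where

open import Level using (0ℓ)
open import Data.Nat as ℕ using (ℕ; zero; suc)
open import Data.Integer as ℤ using (ℤ; +_; -[1+_])
open import Data.Fin using (Fin; zero; suc)
open import Data.Product using (∃; _×_; _,_)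
open import Data.Sum using (_⊎_)
open import Relation.Nullary using (¬_)
open import Relation.Binary using (Rel; IsTotalOrder)
open import Relation.Binary.PropositionalEquality using (_≡_)
open import Algebra.Bundles using (CommutativeRing)

ringFromℕ : (R : CommutativeRing 0ℓ 0ℓ) → ℕ → CommutativeRing.Carrier R
ringFromℕ R zero    = CommutativeRing.0# R
ringFromℕ R (suc n) = CommutativeRing._+_ R (CommutativeRing.1# R) (ringFromℕ R n)

ringFromℤ : (R : CommutativeRing 0ℓ 0ℓ) → ℤ → CommutativeRing.Carrier R
ringFromℤ R (+ n)    = ringFromℕ R n
ringFromℤ R -[1+ n ] = CommutativeRing.-_ R (ringFromℕ R (suc n))

ringSumFin : (R : CommutativeRing 0ℓ 0ℓ) → ∀ {d} → (Fin d → CommutativeRing.Carrier R)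
           → CommutativeRing.Carrier R
ringSumFin R {zero}  f = CommutativeRing.0# R
ringSumFin R {suc d} f = CommutativeRing._+_ R (f zero) (ringSumFin R (λ i → f (suc i)))

-- An Archimedean ordered field (the real numbers are the model of interest;
-- every Archimedean ordered field embeds into ℝ, and ℝ is one).
record ArchOrderedField : Set₁ where
  field
    commutativeRing : CommutativeRing 0ℓ 0ℓ
  open CommutativeRing commutativeRing public

  fromℕ : ℕ → Carrier
  fromℕ = ringFromℕ commutativeRing

  field
    _≤_         : Rel Carrier 0ℓ
    isTotalOrder : IsTotalOrder _≈_ _≤_
    +-mono-≤    : ∀ {x y} z → x ≤ y → (x + z) ≤ (y + z)
    *-nonneg    : ∀ {x y} → 0# ≤ x → 0# ≤ y → 0# ≤ (x * y)
    0≉1         : ¬ (0# ≈ 1#)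
    inverse     : ∀ x → ¬ (x ≈ 0#) → ∃ λ y → (x * y) ≈ 1#

    archimedean : ∀ x → ∃ λ n → x ≤ fromℕ n

  fromℤ : ℤ → Carrier
  fromℤ = ringFromℤ commutativeRing

  sumFin : ∀ {d} → (Fin d → Carrier) → Carrier
  sumFin = ringSumFin commutativeRing

  Satisfies : ∀ {d} → (Fin d → Carrier) → Carrier → (Fin d → ℤ) → Set
  Satisfies a b x = sumFin (λ i → a i * fromℤ (x i)) ≤ b

  IsRelaxation : ∀ {d m} → (Fin m → Fin d → Carrier) → (Fin m → Carrier)
               → ((Fin d → ℤ) → Set) → Set
  IsRelaxation A b X =
    ∀ x → ((∀ r → Satisfies (A r) (b r) x) → X x) × (X x → ∀ r → Satisfies (A r) (b r) x)

unit : ∀ {d} → Fin d → Fin d → ℤ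
unit zero    zero    = + 1
unit zero    (suc i) = + 0
unit (suc j) zero    = + 0
unit (suc j) (suc i) = unit j i

InΔ : ∀ d → (Fin d → ℤ) → Set
InΔ d x = (∀ i → x i ≡ + 0) ⊎ ∃ λ (j : Fin d) → ∀ i → x i ≡ unit j i

-- Homogenizing a relaxation A x ≤ b of Δ_d with m inequalities gives the nonnegative
-- m × (d + 1) matrix W with rows (b_r, b_r − A_r): for lattice points p, q ∈ ℕ^(d+1) whose
-- coordinate sums differ by one, W q ≤ W p holds rowwise only if p − q is a unit vector.
-- No nonnegative matrix with M rows and more than (M + 1)! columns has this property, so
-- m ≥ k when d = k!. If some column j is positive in every row, the pigeonhole principle
-- gives distinct x, y ∈ {0..N}^s with equal coordinate sums such that, in every row, the
-- values of 2x and 2y differ by at most the entry in column j; comparing e_j + 2x with 2y,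
-- and e_j + 2y with 2x, contradicts parity. Otherwise every column has a zero entry, so
-- some row vanishes on more than M! columns; restricting to these columns and deleting
-- that row keeps the property with one row less. Entries are compared with 0 only under a
-- double negation, which is harmless because the goal is a contradiction.

module Submission where

open import Defs
open import Data.Nat using (ℕ; zero; suc; _≤_; _<_; z≤n; s≤s; _!)
import Data.Nat as ℕ
import Data.Nat.Properties as ℕ
open import Data.Fin using (Fin; zero; suc; toℕ; fromℕ<; combine; funToFin; finToFun; punchOut)
import Data.Fin.Properties as Fin
open import Data.Integer as ℤ using (_⊖_)
import Data.Integer.Properties as ℤ
open import Data.Product using (∃; ∃₂; _×_; _,_; proj₁; proj₂)
open import Data.Sum using (inj₁; inj₂)
open import Data.Vec.Functional using (Vector; removeAt; _∷_)
open import Function using (_∘_)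
open import Relation.Nullary using (¬_; Dec; yes; no; does; contradiction)
open import Relation.Nullary.Decidable using (dec-true; ¬¬-excluded-middle)
open import Relation.Unary using (Decidable)
open import Relation.Binary.PropositionalEquality
  using (_≡_; _≗_; refl; sym; trans; cong; cong₂; subst; subst₂; module ≡-Reasoning)
import Algebra.Properties.CommutativeMonoid.Sum
import Relation.Binary.Reasoning.PartialOrder
import Relation.Binary.Reasoning.Setoid
open import Relation.Binary using (IsTotalOrder; Poset)
open Algebra.Properties.CommutativeMonoid.Sum ℕ.+-0-commutativeMonoid
  using (sum; sum-cong-≗; ∑-distrib-+; ∑-comm)

-- ℕ arithmetic is opened only in this block, so that the field's _+_ and _*_ are unambiguous below.
module _ where

  open import Data.Nat using (_+_; _*_; _^_)
  open import Data.Nat.Divisibility using (∣⇒≤; m≤n⇒m!∣n!)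
  open import Data.Nat.Properties using (_!≢0; module ≤-Reasoning)
  open import Data.Bool using (if_then_else_)
  open import Algebra.Properties.CommutativeSemigroup ℕ.*-commutativeSemigroup
    using () renaming (interchange to *-interchange)

  unitℕ : ∀ {d} → Fin d → Fin d → ℕ
  unitℕ zero    zero    = 1
  unitℕ zero    (suc i) = 0
  unitℕ (suc j) zero    = 0
  unitℕ (suc j) (suc i) = unitℕ j i

  unit≡+unitℕ : ∀ {d} (j i : Fin d) → unit j i ≡ ℤ.+ unitℕ j i
  unit≡+unitℕ zero    zero    = refl
  unit≡+unitℕ zero    (suc i) = refl
  unit≡+unitℕ (suc j) zero    = refl
  unit≡+unitℕ (suc j) (suc i) = unit≡+unitℕ j i

  unitℕ≤1 : ∀ {d} (j i : Fin d) → unitℕ j i ≤ 1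
  unitℕ≤1 zero    zero    = ℕ.≤-refl
  unitℕ≤1 zero    (suc i) = z≤n
  unitℕ≤1 (suc j) zero    = z≤n
  unitℕ≤1 (suc j) (suc i) = unitℕ≤1 j i

  sum-const : ∀ n c → sum {n} (λ _ → c) ≡ n * c
  sum-const zero    c = refl
  sum-const (suc n) c = cong (c +_) (sum-const n c)

  sum-unitℕ : ∀ {d} (j : Fin d) → sum (unitℕ j) ≡ 1
  sum-unitℕ {suc d} zero    = cong suc (trans (sum-const d 0) (ℕ.*-zeroʳ d))
  sum-unitℕ {suc d} (suc j) = sum-unitℕ j

  sum-mono-≤ : ∀ {n} {f g : Fin n → ℕ} → (∀ i → f i ≤ g i) → sum f ≤ sum g
  sum-mono-≤ {zero}  f≤g = z≤n
  sum-mono-≤ {suc n} f≤g = ℕ.+-mono-≤ (f≤g zero) (sum-mono-≤ (f≤g ∘ suc))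

  ≤-sum : ∀ {n} (f : Fin n → ℕ) i → f i ≤ sum f
  ≤-sum f zero    = ℕ.m≤m+n (f zero) _
  ≤-sum f (suc i) = ℕ.≤-trans (≤-sum (f ∘ suc) i) (ℕ.m≤n+m _ (f zero))

  count : ∀ {s} {P : Fin s → Set} → Decidable P → ℕ
  count P? = sum (λ k → if does (P? k) then 1 else 0)

  crowded-row : ∀ {n s c} {P : Fin n → Fin s → Set} (P? : ∀ r → Decidable (P r)) →
                (∀ k → ∃ λ r → P r k) → n * c < s → ∃ λ r → c < count (P? r)
  crowded-row {n} {s} {c} {P} P? occupied n*c<s with Fin.any? (λ r → c ℕ.<? count (P? r))
  ... | yes crowded = crowded
  ... | no ¬crowded = contradiction n*c<s (ℕ.≤⇒≯ (begin
    s                            ≡⟨ trans (sum-const s 1) (ℕ.*-identityʳ s) ⟨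
    sum {s} (λ _ → 1)            ≤⟨ sum-mono-≤ hit ⟩
    sum (λ k → sum (λ r → χ r k)) ≡⟨ ∑-comm χ ⟨
    sum (λ r → count (P? r))     ≤⟨ sum-mono-≤ (λ r → ℕ.≮⇒≥ (¬crowded ∘ (r ,_))) ⟩
    sum {n} (λ _ → c)            ≡⟨ sum-const n c ⟩
    n * c                        ∎))
    where
    open ≤-Reasoning
    χ : Fin n → Fin s → ℕ
    χ r k = if does (P? r k) then 1 else 0
    hit : ∀ k → 1 ≤ sum (λ r → χ r k)
    hit k with r , Prk ← occupied k =
      ℕ.≤-trans (ℕ.≤-reflexive (sym (cong (if_then 1 else 0) (dec-true (P? r k) Prk)))) (≤-sum (λ r → χ r k) r)

  data Thinning : ℕ → ℕ → Set where
    done : Thinning 0 0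
    keep : ∀ {a b} → Thinning a b → Thinning (suc a) (suc b)
    skip : ∀ {a b} → Thinning a b → Thinning a (suc b)

  embed : ∀ {a b} → Thinning a b → Fin a → Fin b
  embed (keep θ) zero    = zero
  embed (keep θ) (suc k) = suc (embed θ k)
  embed (skip θ) k       = suc (embed θ k)

  zeroExtend : ∀ {a b} → Thinning a b → (Fin a → ℕ) → Fin b → ℕ
  zeroExtend done     p ()
  zeroExtend (keep θ) p zero    = p zero
  zeroExtend (keep θ) p (suc i) = zeroExtend θ (p ∘ suc) i
  zeroExtend (skip θ) p zero    = 0
  zeroExtend (skip θ) p (suc i) = zeroExtend θ p i

  zeroExtend-embed : ∀ {a b} (θ : Thinning a b) p k → zeroExtend θ p (embed θ k) ≡ p k
  zeroExtend-embed (keep θ) p zero    = refl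
  zeroExtend-embed (keep θ) p (suc k) = zeroExtend-embed θ (p ∘ suc) k
  zeroExtend-embed (skip θ) p k       = zeroExtend-embed θ p k

  sum-zeroExtend : ∀ {a b} (θ : Thinning a b) p → sum (zeroExtend θ p) ≡ sum p
  sum-zeroExtend done     p = refl
  sum-zeroExtend (keep θ) p = cong (p zero +_) (sum-zeroExtend θ (p ∘ suc))
  sum-zeroExtend (skip θ) p = sum-zeroExtend θ p

  select : ∀ {s} {P : Fin s → Set} (P? : Decidable P) → Thinning (count P?) s
  select {zero}  P? = done
  select {suc s} P? with P? zero
  ... | yes _ = keep (select (P? ∘ suc))
  ... | no  _ = skip (select (P? ∘ suc))

  select-sound : ∀ {s} {P : Fin s → Set} (P? : Decidable P) k → P (embed (select P?) k)
  select-sound {suc s} P? k with P? zero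
  select-sound {suc s} P? zero    | yes P0 = P0
  select-sound {suc s} P? (suc k) | yes _  = select-sound (P? ∘ suc) k
  select-sound {suc s} P? k       | no  _  = select-sound (P? ∘ suc) k

  funToFin-cong : ∀ {m n} {f g : Fin m → Fin n} → f ≗ g → funToFin f ≡ funToFin g
  funToFin-cong {zero}  f≗g = refl
  funToFin-cong {suc m} f≗g = cong₂ combine (f≗g zero) (funToFin-cong (f≗g ∘ suc))

  pigeonhole-fun : ∀ {a b m n} → n ^ b < m ^ a → (f : (Fin a → Fin m) → Fin b → Fin n) →
                   ∃₂ λ x y → ¬ (x ≗ y) × f x ≗ f y
  pigeonhole-fun {a} {b} {m} {n} lt f
    with i , j , i<j , fi≡fj ← Fin.pigeonhole lt (funToFin ∘ f ∘ finToFun {m} {a}) =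
    decode i , decode j , distinct , same
    where
    open ≡-Reasoning
    decode : Fin (m ^ a) → Fin a → Fin m
    decode = finToFun
    distinct : ¬ (decode i ≗ decode j)
    distinct x≗y = Fin.<⇒≢ i<j (begin
      i                    ≡⟨ Fin.funToFin-finToFin {a} {m} i ⟨
      funToFin (decode i)  ≡⟨ funToFin-cong x≗y ⟩
      funToFin (decode j)  ≡⟨ Fin.funToFin-finToFin {a} {m} j ⟩
      j                    ∎)
    same : f (decode i) ≗ f (decode j)
    same k = begin
      f (decode i) k                        ≡⟨ Fin.finToFun-funToFin (f (decode i)) k ⟨
      finToFun (funToFin (f (decode i))) k  ≡⟨ cong (λ c → finToFun c k) fi≡fj ⟩
      finToFun (funToFin (f (decode j))) k  ≡⟨ Fin.finToFun-funToFin (f (decode j)) k ⟩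
      f (decode j) k                        ∎

  ^-distribʳ-* : ∀ m n o → (m * n) ^ o ≡ m ^ o * n ^ o
  ^-distribʳ-* m n zero    = refl
  ^-distribʳ-* m n (suc o) = trans (cong (m * n *_) (^-distribʳ-* m n o))
                                   (*-interchange m n (m ^ o) (n ^ o))

  !-mono-≤ : ∀ {m n} → m ≤ n → m ! ≤ n !
  !-mono-≤ {n = n} m≤n = ∣⇒≤ {{n !≢0}} (m≤n⇒m!∣n! m≤n)

  n≤n! : ∀ n → n ≤ n !
  n≤n! zero    = z≤n
  n≤n! (suc n) = ℕ.m≤m*n (suc n) (n !) {{n !≢0}}

  pigeonhole-bound : ∀ {C M s} → 1 ≤ C → suc (suc M) ≤ s →
                 suc (C * C ^ suc M) ^ suc M < suc (C ^ suc M) ^ s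
  pigeonhole-bound {C} {M} {s} 1≤C 2+M≤s = begin-strict
    suc (C * N) ^ suc M    ≤⟨ ℕ.^-monoˡ-≤ (suc M) 1+CN≤C[1+N] ⟩
    (C * suc N) ^ suc M    ≡⟨ ^-distribʳ-* C (suc N) (suc M) ⟩
    N * suc N ^ suc M      <⟨ ℕ.*-monoˡ-< (suc N ^ suc M) {{ℕ.m^n≢0 (suc N) (suc M)}} (ℕ.n<1+n N) ⟩
    suc N ^ suc (suc M)    ≤⟨ ℕ.^-monoʳ-≤ (suc N) 2+M≤s ⟩
    suc N ^ s              ∎
    where
    open ≤-Reasoning
    N = C ^ suc M
    1+CN≤C[1+N] : suc (C * N) ≤ C * suc N
    1+CN≤C[1+N] = ℕ.≤-trans (ℕ.+-monoˡ-≤ (C * N) 1≤C) (ℕ.≤-reflexive (sym (ℕ.*-suc C N)))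

  double : ∀ {s} → (Fin s → ℕ) → Fin s → ℕ
  double x k = x k + x k

  double-≤-cancel : ∀ {b x y} → b ≤ 1 → y + y ≤ b + (x + x) → y ≤ x
  double-≤-cancel {b} {x} {y} b≤1 2y≤b+2x = ℕ.≮⇒≥ λ x<y → ℕ.<-irrefl refl (begin-strict
    suc x + suc x        ≤⟨ ℕ.+-mono-≤ x<y x<y ⟩
    y + y                ≤⟨ 2y≤b+2x ⟩
    b + (x + x)          ≤⟨ ℕ.+-monoˡ-≤ (x + x) b≤1 ⟩
    suc (x + x)          <⟨ ℕ.n<1+n _ ⟩
    suc (suc (x + x))    ≡⟨ cong suc (ℕ.+-suc x x) ⟨
    suc x + suc x        ∎)
    where open ≤-Reasoning

  m⊖n≡+o⇒m≡o+n : ∀ m n o → m ⊖ n ≡ ℤ.+ o → m ≡ o + n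
  m⊖n≡+o⇒m≡o+n m n o m⊖n≡o = ℤ.+-injective (begin
    ℤ.+ m                  ≡⟨ ℤ.+-cancelˡ-⊖ n m 0 ⟨
    (n + m) ⊖ (n + 0)      ≡⟨ cong₂ _⊖_ (ℕ.+-comm n m) (ℕ.+-identityʳ n) ⟩
    (m + n) ⊖ n            ≡⟨ ℤ.distribˡ-⊖-+-pos n m n ⟨
    (m ⊖ n) ℤ.+ ℤ.+ n      ≡⟨ cong (ℤ._+ ℤ.+ n) m⊖n≡o ⟩
    ℤ.+ (o + n)            ∎)
    where open ≡-Reasoning

  InΔ-difference : ∀ {d} (p q : Fin d → ℕ) → InΔ d (λ i → p i ⊖ q i) →
                   (∀ i → q i ≤ p i) × sum p ≤ suc (sum q)
  InΔ-difference p q (inj₁ p⊖q≡0) =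
    (λ i → ℕ.≤-reflexive (sym (p≡q i))) , ℕ.m≤n⇒m≤1+n (ℕ.≤-reflexive (sum-cong-≗ p≡q))
    where
    p≡q : p ≗ q
    p≡q i = m⊖n≡+o⇒m≡o+n (p i) (q i) 0 (p⊖q≡0 i)
  InΔ-difference p q (inj₂ (j , p⊖q≡e)) =
    (λ i → ℕ.≤-trans (ℕ.m≤n+m (q i) _) (ℕ.≤-reflexive (sym (p≡e+q i)))) , ℕ.≤-reflexive (begin
    sum p                          ≡⟨ sum-cong-≗ p≡e+q ⟩
    sum (λ i → unitℕ j i + q i)    ≡⟨ ∑-distrib-+ (unitℕ j) q ⟩
    sum (unitℕ j) + sum q          ≡⟨ cong (_+ sum q) (sum-unitℕ j) ⟩
    suc (sum q)                    ∎)
    where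
    open ≡-Reasoning
    p≡e+q : ∀ i → p i ≡ unitℕ j i + q i
    p≡e+q i = m⊖n≡+o⇒m≡o+n (p i) (q i) (unitℕ j i) (trans (p⊖q≡e i) (unit≡+unitℕ j i))

  m+n≡1+o+p⇒n≤1+p⇒o≤m : ∀ {m n o p} → m + n ≡ suc (o + p) → n ≤ suc p → o ≤ m
  m+n≡1+o+p⇒n≤1+p⇒o≤m {m} {n} {o} {p} eq n≤1+p = ℕ.+-cancelʳ-≤ (suc p) o m (begin
    o + suc p    ≡⟨ ℕ.+-suc o p ⟩
    suc (o + p)  ≡⟨ eq ⟨
    m + n        ≤⟨ ℕ.+-monoʳ-≤ m n≤1+p ⟩
    m + suc p    ∎)
    where open ≤-Reasoning

  ¬¬-Π-Fin : ∀ {n} {B : Fin n → Set} → (∀ i → ¬ ¬ B i) → ¬ ¬ (∀ i → B i)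
  ¬¬-Π-Fin {zero}  _   ¬all = ¬all λ ()
  ¬¬-Π-Fin {suc n} ¬¬B ¬all =
    ¬¬B zero λ b₀ → ¬¬-Π-Fin (¬¬B ∘ suc) λ bs → ¬all λ { zero → b₀ ; (suc i) → bs i }

module _ (F : ArchOrderedField) where

  open ArchOrderedField F
    renaming (_≤_ to infix 4 _≤ᶠ_; +-mono-≤ to +-monoˡ-≤ᶠ; refl to ≈-refl; sym to ≈-sym; trans to ≈-trans)
    hiding (zero)
  open import Algebra.Properties.Ring ring using (-‿distribˡ-*; x[y-z]≈xy-xz; [y-z]x≈yx-zx)
  open import Algebra.Properties.AbelianGroup +-abelianGroup using (⁻¹-∙-comm; ε⁻¹≈ε; ⁻¹-involutive)
  open import Algebra.Properties.Semiring.Sum semiring using (*-distribˡ-sum; *-distribʳ-sum)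
  open import Algebra.Properties.CommutativeSemigroup *-commutativeSemigroup using (xy∙z≈xz∙y)
  open import Algebra.Properties.CommutativeSemigroup +-commutativeSemigroup
    using () renaming (interchange to +-interchange)
  module ≈-Reasoning = Relation.Binary.Reasoning.Setoid setoid
  module Σᶠ = Algebra.Properties.CommutativeMonoid.Sum +-commutativeMonoid
  module ≤ᶠ = IsTotalOrder isTotalOrder

  ≤ᶠ-poset : Poset _ _ _
  ≤ᶠ-poset = record { isPartialOrder = ≤ᶠ.isPartialOrder }

  module ≤ᶠ-Reasoning = Relation.Binary.Reasoning.PartialOrder ≤ᶠ-poset

  ≤ᶠ-resp-≈ : ∀ {x x′ y y′} → x ≈ x′ → y ≈ y′ → x ≤ᶠ y → x′ ≤ᶠ y′
  ≤ᶠ-resp-≈ x≈x′ y≈y′ = ≤ᶠ.≤-respˡ-≈ x≈x′ ∘ ≤ᶠ.≤-respʳ-≈ y≈y′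

  +-monoʳ-≤ᶠ : ∀ z {x y} → x ≤ᶠ y → z + x ≤ᶠ z + y
  +-monoʳ-≤ᶠ z {x} {y} x≤y = ≤ᶠ-resp-≈ (+-comm x z) (+-comm y z) (+-monoˡ-≤ᶠ z x≤y)

  +-mono-≤ᶠ : ∀ {x y u v} → x ≤ᶠ y → u ≤ᶠ v → x + u ≤ᶠ y + v
  +-mono-≤ᶠ {y = y} {u} x≤y u≤v = ≤ᶠ.trans (+-monoˡ-≤ᶠ u x≤y) (+-monoʳ-≤ᶠ y u≤v)

  x≤y⇒0≤y-x : ∀ {x y} → x ≤ᶠ y → 0# ≤ᶠ y - x
  x≤y⇒0≤y-x {x} {y} x≤y = ≤ᶠ.≤-respˡ-≈ (-‿inverseʳ x) (+-monoˡ-≤ᶠ (- x) x≤y)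

  0≤y-x⇒x≤y : ∀ {x y} → 0# ≤ᶠ y - x → x ≤ᶠ y
  0≤y-x⇒x≤y {x} {y} 0≤y-x = ≤ᶠ-resp-≈ (+-identityˡ x) y-x+x≈y (+-monoˡ-≤ᶠ x 0≤y-x)
    where
    y-x+x≈y : y - x + x ≈ y
    y-x+x≈y = ≈-trans (+-assoc y (- x) x) (≈-trans (+-congˡ (-‿inverseˡ x)) (+-identityʳ y))

  *-monoˡ-≤ᶠ-nonNeg : ∀ {z x y} → 0# ≤ᶠ z → x ≤ᶠ y → x * z ≤ᶠ y * z
  *-monoˡ-≤ᶠ-nonNeg {z} {x} {y} 0≤z x≤y =
    0≤y-x⇒x≤y (≤ᶠ.≤-respʳ-≈ ([y-z]x≈yx-zx z y x) (*-nonneg (x≤y⇒0≤y-x x≤y) 0≤z))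

  *-monoʳ-≤ᶠ-nonNeg : ∀ {z x y} → 0# ≤ᶠ z → x ≤ᶠ y → z * x ≤ᶠ z * y
  *-monoʳ-≤ᶠ-nonNeg {z} {x} {y} 0≤z x≤y = ≤ᶠ-resp-≈ (*-comm x z) (*-comm y z) (*-monoˡ-≤ᶠ-nonNeg 0≤z x≤y)

  0≤1 : 0# ≤ᶠ 1#
  0≤1 with ≤ᶠ.total 0# 1#
  ... | inj₁ 0≤1 = 0≤1
  ... | inj₂ 1≤0 = ≤ᶠ.≤-respʳ-≈ -1*-1≈1 (*-nonneg 0≤-1 0≤-1)
    where
    0≤-1 : 0# ≤ᶠ - 1#
    0≤-1 = ≤ᶠ-resp-≈ (-‿inverseʳ 1#) (+-identityˡ (- 1#)) (+-monoˡ-≤ᶠ (- 1#) 1≤0)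
    -1*-1≈1 : - 1# * - 1# ≈ 1#
    -1*-1≈1 = ≈-trans (≈-sym (-‿distribˡ-* 1# (- 1#)))
                      (≈-trans (-‿cong (*-identityˡ (- 1#))) (⁻¹-involutive 1#))

  fromℕ-+ : ∀ m n → fromℕ (m ℕ.+ n) ≈ fromℕ m + fromℕ n
  fromℕ-+ zero    n = ≈-sym (+-identityˡ (fromℕ n))
  fromℕ-+ (suc m) n = ≈-trans (+-congˡ (fromℕ-+ m n)) (≈-sym (+-assoc 1# (fromℕ m) (fromℕ n)))

  fromℕ-* : ∀ m n → fromℕ (m ℕ.* n) ≈ fromℕ m * fromℕ n
  fromℕ-* zero    n = ≈-sym (zeroˡ (fromℕ n))
  fromℕ-* (suc m) n = begin
    fromℕ (n ℕ.+ m ℕ.* n)          ≈⟨ fromℕ-+ n (m ℕ.* n) ⟩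
    fromℕ n + fromℕ (m ℕ.* n)      ≈⟨ +-cong (≈-sym (*-identityˡ (fromℕ n))) (fromℕ-* m n) ⟩
    1# * fromℕ n + fromℕ m * fromℕ n ≈⟨ distribʳ (fromℕ n) 1# (fromℕ m) ⟨
    (1# + fromℕ m) * fromℕ n       ∎
    where open ≈-Reasoning

  fromℕ-nonNeg : ∀ n → 0# ≤ᶠ fromℕ n
  fromℕ-nonNeg zero    = ≤ᶠ.refl
  fromℕ-nonNeg (suc n) = ≤ᶠ.≤-respˡ-≈ (+-identityˡ 0#) (+-mono-≤ᶠ 0≤1 (fromℕ-nonNeg n))

  fromℕ-mono-≤ : ∀ {m n} → m ≤ n → fromℕ m ≤ᶠ fromℕ n
  fromℕ-mono-≤ {m} {n} m≤n = ≤ᶠ-resp-≈ (+-identityʳ (fromℕ m)) m+[n-m]≈n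
    (+-monoʳ-≤ᶠ (fromℕ m) (fromℕ-nonNeg (n ℕ.∸ m)))
    where
    m+[n-m]≈n : fromℕ m + fromℕ (n ℕ.∸ m) ≈ fromℕ n
    m+[n-m]≈n = ≈-trans (≈-sym (fromℕ-+ m (n ℕ.∸ m))) (reflexive (cong fromℕ (ℕ.m+[n∸m]≡n m≤n)))

  fromℤ-⊖ : ∀ m n → fromℤ (m ⊖ n) ≈ fromℕ m - fromℕ n
  fromℤ-⊖ zero    zero    = ≈-sym (-‿inverseʳ 0#)
  fromℤ-⊖ zero    (suc n) = ≈-sym (+-identityˡ _)
  fromℤ-⊖ (suc m) zero    = ≈-sym (≈-trans (+-congˡ ε⁻¹≈ε) (+-identityʳ _))
  fromℤ-⊖ (suc m) (suc n) = begin
    fromℤ (suc m ⊖ suc n)              ≡⟨ cong fromℤ (ℤ.[1+m]⊖[1+n]≡m⊖n m n) ⟩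
    fromℤ (m ⊖ n)                      ≈⟨ fromℤ-⊖ m n ⟩
    fromℕ m - fromℕ n                  ≈⟨ +-identityˡ _ ⟨
    0# + (fromℕ m - fromℕ n)           ≈⟨ +-congʳ (-‿inverseʳ 1#) ⟨
    (1# - 1#) + (fromℕ m - fromℕ n)    ≈⟨ +-interchange 1# (- 1#) (fromℕ m) (- fromℕ n) ⟩
    (1# + fromℕ m) + (- 1# - fromℕ n)  ≈⟨ +-congˡ (⁻¹-∙-comm 1# (fromℕ n)) ⟩
    fromℕ (suc m) - fromℕ (suc n)      ∎
    where open ≈-Reasoning

  archimedean-* : ∀ {e} → 0# ≤ᶠ e → ¬ (e ≤ᶠ 0#) → ∀ x → ∃ λ n → x ≤ᶠ fromℕ n * e
  archimedean-* {e} 0≤e e≰0 x with inverse e (e≰0 ∘ ≤ᶠ.reflexive)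
  ... | y , ey≈1 with archimedean (x * y)
  ...   | n , xy≤n = n , ≤ᶠ.≤-respˡ-≈ xye≈x (*-monoˡ-≤ᶠ-nonNeg 0≤e xy≤n)
    where
    xye≈x : x * y * e ≈ x
    xye≈x = ≈-trans (*-assoc x y e) (≈-trans (*-congˡ (≈-trans (*-comm y e) ey≈1)) (*-identityʳ x))

  archimedean-*-uniform : ∀ {M} (x e : Fin M → Carrier) → (∀ r → 0# ≤ᶠ e r) → (∀ r → ¬ (e r ≤ᶠ 0#)) →
                        ∀ n → ∃ λ C → n ≤ C × (∀ r → x r ≤ᶠ fromℕ C * e r)
  archimedean-*-uniform {zero}  x e e≥0 e≰0 n = n , ℕ.≤-refl , λ ()
  archimedean-*-uniform {suc M} x e e≥0 e≰0 n
    with C₀ , x₀≤C₀e₀ ← archimedean-* (e≥0 zero) (e≰0 zero) (x zero)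
       | C , n≤C , x≤Ce ← archimedean-*-uniform (x ∘ suc) (e ∘ suc) (e≥0 ∘ suc) (e≰0 ∘ suc) n =
    C₀ ℕ.+ C , ℕ.≤-trans n≤C (ℕ.m≤n+m C C₀) , λ where
      zero    → ≤ᶠ.trans x₀≤C₀e₀ (scale (ℕ.m≤m+n C₀ C) zero)
      (suc r) → ≤ᶠ.trans (x≤Ce r) (scale (ℕ.m≤n+m C C₀) (suc r))
    where
    scale : ∀ {a b} → a ≤ b → ∀ r → fromℕ a * e r ≤ᶠ fromℕ b * e r
    scale a≤b r = *-monoˡ-≤ᶠ-nonNeg (e≥0 r) (fromℕ-mono-≤ a≤b)

  sumFin≡sum : ∀ {n} (f : Vector Carrier n) → sumFin f ≡ Σᶠ.sum f
  sumFin≡sum {zero}  f = refl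
  sumFin≡sum {suc n} f = cong (f zero +_) (sumFin≡sum (f ∘ suc))

  sum-mono-≤ᶠ : ∀ {n} {f g : Vector Carrier n} → (∀ k → f k ≤ᶠ g k) → Σᶠ.sum f ≤ᶠ Σᶠ.sum g
  sum-mono-≤ᶠ {zero}  f≤g = ≤ᶠ.refl
  sum-mono-≤ᶠ {suc n} f≤g = +-mono-≤ᶠ (f≤g zero) (sum-mono-≤ᶠ (f≤g ∘ suc))

  sum-neg : ∀ {n} (f : Vector Carrier n) → Σᶠ.sum (λ k → - f k) ≈ - Σᶠ.sum f
  sum-neg {zero}  f = ≈-sym ε⁻¹≈ε
  sum-neg {suc n} f = ≈-trans (+-congˡ (sum-neg (f ∘ suc))) (⁻¹-∙-comm (f zero) (Σᶠ.sum (f ∘ suc)))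

  sum-sub : ∀ {n} (f g : Vector Carrier n) → Σᶠ.sum (λ k → f k - g k) ≈ Σᶠ.sum f - Σᶠ.sum g
  sum-sub f g = ≈-trans (Σᶠ.∑-distrib-+ f (λ k → - g k)) (+-congˡ (sum-neg g))

  infix 8 _∙_
  _∙_ : ∀ {n} → Vector Carrier n → Vector Carrier n → Carrier
  w ∙ u = Σᶠ.sum (λ k → w k * u k)

  ⟦_⟧ : ∀ {n} → (Fin n → ℕ) → Vector Carrier n
  ⟦ p ⟧ k = fromℕ (p k)

  sum-⟦⟧ : ∀ {n} (p : Fin n → ℕ) → Σᶠ.sum ⟦ p ⟧ ≈ fromℕ (sum p)
  sum-⟦⟧ {zero}  p = ≈-refl
  sum-⟦⟧ {suc n} p = ≈-trans (+-congˡ (sum-⟦⟧ (p ∘ suc))) (≈-sym (fromℕ-+ (p zero) (sum (p ∘ suc))))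

  ∙-congˡ : ∀ {n} (w : Vector Carrier n) {u v} → (∀ k → u k ≈ v k) → w ∙ u ≈ w ∙ v
  ∙-congˡ w u≈v = Σᶠ.sum-cong-≋ (λ k → *-congˡ (u≈v k))

  ∙-distrib-+ : ∀ {n} (w u v : Vector Carrier n) → w ∙ (λ k → u k + v k) ≈ w ∙ u + w ∙ v
  ∙-distrib-+ w u v = ≈-trans (Σᶠ.sum-cong-≋ (λ k → distribˡ (w k) (u k) (v k)))
                              (Σᶠ.∑-distrib-+ (λ k → w k * u k) (λ k → w k * v k))

  ∙-distrib-- : ∀ {n} (w u v : Vector Carrier n) → w ∙ (λ k → u k - v k) ≈ w ∙ u - w ∙ v
  ∙-distrib-- w u v = ≈-trans (Σᶠ.sum-cong-≋ (λ k → x[y-z]≈xy-xz (w k) (u k) (v k)))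
                              (sum-sub (λ k → w k * u k) (λ k → w k * v k))

  ∙-vanish : ∀ {n} {w : Vector Carrier n} (u : Vector Carrier n) → (∀ k → w k ≈ 0#) → w ∙ u ≈ 0#
  ∙-vanish {n} u w≈0 = ≈-trans (Σᶠ.sum-cong-≋ (λ k → ≈-trans (*-congʳ (w≈0 k)) (zeroˡ (u k))))
                               (Σᶠ.sum-replicate-zero n)

  ∙-zeroʳ : ∀ {n} (w : Vector Carrier n) → w ∙ (λ _ → 0#) ≈ 0#
  ∙-zeroʳ {n} w = ≈-trans (Σᶠ.sum-cong-≋ (λ k → zeroʳ (w k))) (Σᶠ.sum-replicate-zero n)

  ∙-const : ∀ {n} (w : Vector Carrier n) c → w ∙ (λ _ → c) ≈ Σᶠ.sum w * c
  ∙-const w c = ≈-sym (*-distribʳ-sum c w)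

  ∙-unit : ∀ {n} (w : Vector Carrier n) j → w ∙ ⟦ unitℕ j ⟧ ≈ w j
  ∙-unit {suc n} w zero    = ≈-trans (+-cong (≈-trans (*-congˡ (+-identityʳ 1#)) (*-identityʳ (w zero)))
                                               (∙-zeroʳ (w ∘ suc)))
                                     (+-identityʳ (w zero))
  ∙-unit {suc n} w (suc j) = ≈-trans (+-cong (zeroʳ (w zero)) (∙-unit (w ∘ suc) j)) (+-identityˡ (w (suc j)))

  ∙-mono-≤ᶠ : ∀ {n} {w u v : Vector Carrier n} → (∀ k → 0# ≤ᶠ w k) → (∀ k → u k ≤ᶠ v k) → w ∙ u ≤ᶠ w ∙ v
  ∙-mono-≤ᶠ w≥0 u≤v = sum-mono-≤ᶠ (λ k → *-monoʳ-≤ᶠ-nonNeg (w≥0 k) (u≤v k))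

  ∙-nonNeg : ∀ {n} {w u : Vector Carrier n} → (∀ k → 0# ≤ᶠ w k) → (∀ k → 0# ≤ᶠ u k) → 0# ≤ᶠ w ∙ u
  ∙-nonNeg {w = w} w≥0 u≥0 = ≤ᶠ.≤-respˡ-≈ (∙-zeroʳ w) (∙-mono-≤ᶠ w≥0 u≥0)

  ∙-zeroExtend : ∀ {a b} (θ : Thinning a b) (w : Vector Carrier b) p →
                 w ∙ ⟦ zeroExtend θ p ⟧ ≈ (w ∘ embed θ) ∙ ⟦ p ⟧
  ∙-zeroExtend done     w p = ≈-refl
  ∙-zeroExtend (keep θ) w p = +-congˡ (∙-zeroExtend θ (w ∘ suc) (p ∘ suc))
  ∙-zeroExtend (skip θ) w p = ≈-trans (+-cong (zeroʳ (w zero)) (∙-zeroExtend θ (w ∘ suc) p)) (+-identityˡ _)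

  NonNeg : ∀ {M s} → (Fin M → Fin s → Carrier) → Set
  NonNeg W = ∀ r k → 0# ≤ᶠ W r k

  -- As Σp = 1 + Σq, the conclusion q ≤ p says exactly that p − q is a unit vector.
  MonotoneSteps : ∀ {M s} → (Fin M → Fin s → Carrier) → Set
  MonotoneSteps {s = s} W = ∀ (p q : Fin s → ℕ) → sum p ≡ suc (sum q) →
                            (∀ r → W r ∙ ⟦ q ⟧ ≤ᶠ W r ∙ ⟦ p ⟧) → ∀ k → q k ≤ p k

  MonotoneSteps-thin : ∀ {M a b} (W : Fin M → Fin b → Carrier) (θ : Thinning a b) →
                       MonotoneSteps W → MonotoneSteps (λ r → W r ∘ embed θ)
  MonotoneSteps-thin W θ steps p q Σp≡1+Σq q≤ᵂp k =
    subst₂ _≤_ (zeroExtend-embed θ q k) (zeroExtend-embed θ p k)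
      (steps (zeroExtend θ p) (zeroExtend θ q) Σp′≡1+Σq′ q′≤ᵂp′ (embed θ k))
    where
    Σp′≡1+Σq′ : sum (zeroExtend θ p) ≡ suc (sum (zeroExtend θ q))
    Σp′≡1+Σq′ = trans (sum-zeroExtend θ p) (trans Σp≡1+Σq (cong suc (sym (sum-zeroExtend θ q))))
    q′≤ᵂp′ : ∀ r → W r ∙ ⟦ zeroExtend θ q ⟧ ≤ᶠ W r ∙ ⟦ zeroExtend θ p ⟧
    q′≤ᵂp′ r = ≤ᶠ-resp-≈ (≈-sym (∙-zeroExtend θ (W r) q)) (≈-sym (∙-zeroExtend θ (W r) p)) (q≤ᵂp r)

  MonotoneSteps-removeAt : ∀ {M s} (W : Fin (suc M) → Fin s → Carrier) r → (∀ k → W r k ≈ 0#) →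
                           MonotoneSteps W → MonotoneSteps (removeAt W r)
  MonotoneSteps-removeAt W r Wr≈0 steps p q Σp≡1+Σq q≤ᵂp = steps p q Σp≡1+Σq q≤ᵂp′
    where
    q≤ᵂp′ : ∀ r′ → W r′ ∙ ⟦ q ⟧ ≤ᶠ W r′ ∙ ⟦ p ⟧
    q≤ᵂp′ r′ with r Fin.≟ r′
    ... | yes refl = ≤ᶠ-resp-≈ (≈-sym (∙-vanish ⟦ q ⟧ Wr≈0)) (≈-sym (∙-vanish ⟦ p ⟧ Wr≈0)) ≤ᶠ.refl
    ... | no r≢r′  = subst (λ t → W t ∙ ⟦ q ⟧ ≤ᶠ W t ∙ ⟦ p ⟧) (Fin.punchIn-punchOut r≢r′)
                           (q≤ᵂp (punchOut r≢r′))

  record Bucket (e v : Carrier) (L : ℕ) : Set where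
    field
      index   : ℕ
      index≤L : index ≤ L
      below   : v ≤ᶠ fromℕ index * e
      above   : fromℕ index * e ≤ᶠ e + v

  bucket : ∀ {e v} L → 0# ≤ᶠ e + v → v ≤ᶠ fromℕ L * e → Bucket e v L
  bucket {e} zero 0≤e+v v≤0e = record
    { index = 0 ; index≤L = z≤n ; below = v≤0e ; above = ≤ᶠ.≤-respˡ-≈ (≈-sym (zeroˡ e)) 0≤e+v }
  bucket {e} {v} (suc L) 0≤e+v v≤[1+L]e with ≤ᶠ.total v (fromℕ L * e)
  ... | inj₁ v≤Le = record { index = index ; index≤L = ℕ.m≤n⇒m≤1+n index≤L ; below = below ; above = above }
    where open Bucket (bucket L 0≤e+v v≤Le)
  ... | inj₂ Le≤v = record
    { index = suc L ; index≤L = ℕ.≤-refl ; below = v≤[1+L]e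
    ; above = ≤ᶠ.≤-respˡ-≈ [1+L]e≈e+Le (+-monoʳ-≤ᶠ e Le≤v) }
    where
    [1+L]e≈e+Le : e + fromℕ L * e ≈ fromℕ (suc L) * e
    [1+L]e≈e+Le = ≈-sym (≈-trans (distribʳ e 1# (fromℕ L)) (+-congʳ (*-identityˡ e)))

  bucket-close : ∀ {e v v′ L} (b : Bucket e v L) (b′ : Bucket e v′ L) →
                 Bucket.index b ≡ Bucket.index b′ → v′ ≤ᶠ e + v
  bucket-close {e} b b′ same = ≤ᶠ.trans (Bucket.below b′) (subst (λ c → fromℕ c * e ≤ᶠ _) same (Bucket.above b))

  ClosePair : ∀ {M s} → (Fin M → Fin s → Carrier) → (Fin M → Carrier) → Set
  ClosePair {s = s} W e = ∃₂ λ (x y : Fin s → ℕ) → ¬ (x ≗ y) × sum x ≡ sum y ×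
    (∀ r → W r ∙ ⟦ double y ⟧ ≤ᶠ e r + W r ∙ ⟦ double x ⟧) ×
    (∀ r → W r ∙ ⟦ double x ⟧ ≤ᶠ e r + W r ∙ ⟦ double y ⟧)

  close-pair : ∀ {M s} (W : Fin M → Fin s → Carrier) (e : Fin M → Carrier) → NonNeg W → (∀ r → 0# ≤ᶠ e r) →
               suc (suc M) ≤ s → (∃ λ C → s ≤ C × (∀ r → Σᶠ.sum (W r) + Σᶠ.sum (W r) ≤ᶠ fromℕ C * e r)) →
               ClosePair W e
  close-pair {M} {s} W e W≥0 e≥0 2+M≤s (C , s≤C , 2T≤Ce) =
    close (pigeonhole-fun (pigeonhole-bound 1≤C 2+M≤s) profile)
    where
    -- With these sizes the (1 + L)^(M + 1) profiles (level, and bucket in each row) are fewer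
    -- than the (1 + N)^s points of {0..N}^s (pigeonhole-bound).
    N = C ℕ.^ suc M
    L = C ℕ.* N
    1≤C : 1 ≤ C
    1≤C = ℕ.≤-trans (s≤s z≤n) (ℕ.≤-trans 2+M≤s s≤C)
    point : (Fin s → Fin (suc N)) → Fin s → ℕ
    point z k = toℕ (z k)
    point≤N : ∀ z k → point z k ≤ N
    point≤N z k = Fin.toℕ≤pred[n] (z k)
    level≤L : ∀ z → sum (point z) ≤ L
    level≤L z = begin
      sum (point z)        ≤⟨ sum-mono-≤ (point≤N z) ⟩
      sum {s} (λ _ → N)    ≡⟨ sum-const s N ⟩
      s ℕ.* N              ≤⟨ ℕ.*-monoˡ-≤ N s≤C ⟩
      C ℕ.* N              ∎
      where open ℕ.≤-Reasoning
    value : Fin M → (Fin s → Fin (suc N)) → Carrier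
    value r z = W r ∙ ⟦ double (point z) ⟧
    value≤Le : ∀ r z → value r z ≤ᶠ fromℕ L * e r
    value≤Le r z = begin
      W r ∙ ⟦ double (point z) ⟧  ≤⟨ ∙-mono-≤ᶠ (W≥0 r) 2z≤2N ⟩
      W r ∙ (λ _ → fromℕ (N ℕ.+ N)) ≈⟨ ∙-const (W r) (fromℕ (N ℕ.+ N)) ⟩
      T * fromℕ (N ℕ.+ N)         ≈⟨ *-congˡ (fromℕ-+ N N) ⟩
      T * (fromℕ N + fromℕ N)     ≈⟨ distribˡ T (fromℕ N) (fromℕ N) ⟩
      T * fromℕ N + T * fromℕ N   ≈⟨ distribʳ (fromℕ N) T T ⟨
      (T + T) * fromℕ N           ≤⟨ *-monoˡ-≤ᶠ-nonNeg (fromℕ-nonNeg N) (2T≤Ce r) ⟩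
      fromℕ C * e r * fromℕ N     ≈⟨ xy∙z≈xz∙y (fromℕ C) (e r) (fromℕ N) ⟩
      fromℕ C * fromℕ N * e r     ≈⟨ *-congʳ (fromℕ-* C N) ⟨
      fromℕ L * e r               ∎
      where
      open ≤ᶠ-Reasoning
      T = Σᶠ.sum (W r)
      2z≤2N : ∀ k → ⟦ double (point z) ⟧ k ≤ᶠ fromℕ (N ℕ.+ N)
      2z≤2N k = fromℕ-mono-≤ (ℕ.+-mono-≤ (point≤N z k) (point≤N z k))
    bucketOf : ∀ z r → Bucket (e r) (value r z) L
    bucketOf z r = bucket L 0≤e+value (value≤Le r z)
      where
      0≤e+value : 0# ≤ᶠ e r + value r z
      0≤e+value = ≤ᶠ.≤-respˡ-≈ (+-identityˡ 0#)
        (+-mono-≤ᶠ (e≥0 r) (∙-nonNeg (W≥0 r) (λ k → fromℕ-nonNeg (double (point z) k))))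
    profile : (Fin s → Fin (suc N)) → Fin (suc M) → Fin (suc L)
    profile z zero    = fromℕ< (s≤s (level≤L z))
    profile z (suc r) = fromℕ< (s≤s (Bucket.index≤L (bucketOf z r)))
    close-values : ∀ z z′ → profile z ≗ profile z′ → ∀ r → value r z′ ≤ᶠ e r + value r z
    close-values z z′ same r =
      bucket-close (bucketOf z r) (bucketOf z′ r) (Fin.fromℕ<-injective _ _ _ _ (same (suc r)))
    close : (∃₂ λ z z′ → ¬ (z ≗ z′) × profile z ≗ profile z′) → ClosePair W e
    close (z , z′ , z≉z′ , same) =
      point z , point z′ , (λ z≗z′ → z≉z′ (Fin.toℕ-injective ∘ z≗z′)) ,
      Fin.fromℕ<-injective _ _ _ _ (same zero) , close-values z z′ same , close-values z′ z (sym ∘ same)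

  doubled-step : ∀ {M s} (W : Fin M → Fin s → Carrier) → MonotoneSteps W → ∀ j (x y : Fin s → ℕ) → sum x ≡ sum y →
                 (∀ r → W r ∙ ⟦ double y ⟧ ≤ᶠ W r j + W r ∙ ⟦ double x ⟧) → ∀ k → y k ≤ x k
  doubled-step W steps j x y Σx≡Σy 2y≤ᵂe+2x k =
    double-≤-cancel (unitℕ≤1 j k) (steps e+2x (double y) Σe+2x≡1+Σ2y 2y≤ᵂ[e+2x] k)
    where
    e+2x : Fin _ → ℕ
    e+2x i = unitℕ j i ℕ.+ double x i
    Σe+2x≡1+Σ2y : sum e+2x ≡ suc (sum (double y))
    Σe+2x≡1+Σ2y = begin
      sum e+2x                           ≡⟨ ∑-distrib-+ (unitℕ j) (double x) ⟩
      sum (unitℕ j) ℕ.+ sum (double x)   ≡⟨ cong₂ ℕ._+_ (sum-unitℕ j) (∑-distrib-+ x x) ⟩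
      suc (sum x ℕ.+ sum x)              ≡⟨ cong (λ t → suc (t ℕ.+ t)) Σx≡Σy ⟩
      suc (sum y ℕ.+ sum y)              ≡⟨ cong suc (∑-distrib-+ y y) ⟨
      suc (sum (double y))               ∎
      where open ≡-Reasoning
    2y≤ᵂ[e+2x] : ∀ r → W r ∙ ⟦ double y ⟧ ≤ᶠ W r ∙ ⟦ e+2x ⟧
    2y≤ᵂ[e+2x] r = ≤ᶠ.≤-respʳ-≈ (≈-sym (begin
      W r ∙ ⟦ e+2x ⟧                                   ≈⟨ ∙-congˡ (W r) (λ i → fromℕ-+ (unitℕ j i) (double x i)) ⟩
      W r ∙ (λ i → ⟦ unitℕ j ⟧ i + ⟦ double x ⟧ i)     ≈⟨ ∙-distrib-+ (W r) ⟦ unitℕ j ⟧ ⟦ double x ⟧ ⟩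
      W r ∙ ⟦ unitℕ j ⟧ + W r ∙ ⟦ double x ⟧           ≈⟨ +-congʳ (∙-unit (W r) j) ⟩
      W r j + W r ∙ ⟦ double x ⟧                       ∎)) (2y≤ᵂe+2x r)
      where open ≈-Reasoning

  steps⇒¬ClosePair : ∀ {M s} (W : Fin M → Fin s → Carrier) j → MonotoneSteps W → ¬ ClosePair W (λ r → W r j)
  steps⇒¬ClosePair W j steps (x , y , x≉y , Σx≡Σy , 2y≤ᵂe+2x , 2x≤ᵂe+2y) =
    x≉y (λ k → ℕ.≤-antisym (doubled-step W steps j y x (sym Σx≡Σy) 2x≤ᵂe+2y k)
                           (doubled-step W steps j x y Σx≡Σy 2y≤ᵂe+2x k))

  positive-column⇒¬MonotoneSteps : ∀ {M s} (W : Fin M → Fin s → Carrier) → NonNeg W → suc (suc M) ≤ s →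
                                   (j : Fin s) → (∀ r → ¬ (W r j ≤ᶠ 0#)) → ¬ MonotoneSteps W
  positive-column⇒¬MonotoneSteps {s = s} W W≥0 2+M≤s j Wj≰0 steps = steps⇒¬ClosePair W j steps
    (close-pair W (λ r → W r j) W≥0 (λ r → W≥0 r j) 2+M≤s
      (archimedean-*-uniform (λ r → Σᶠ.sum (W r) + Σᶠ.sum (W r)) (λ r → W r j) (λ r → W≥0 r j) Wj≰0 s))

  ¬MonotoneSteps : ∀ {M s} (W : Fin M → Fin s → Carrier) → NonNeg W → (∀ r k → Dec (W r k ≤ᶠ 0#)) →
                   suc M ! < s → ¬ MonotoneSteps W
  ¬MonotoneSteps {zero}  {zero}  _ _   _    ()
  ¬MonotoneSteps {zero}  {suc s} W W≥0 _    2≤s = positive-column⇒¬MonotoneSteps W W≥0 2≤s zero (λ ())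
  ¬MonotoneSteps {suc M} {s}     W W≥0 W≤0? M!<s steps
    with Fin.all? (λ k → Fin.any? (λ r → W≤0? r k))
  ... | no ¬zeros with k , ¬zero ← Fin.¬∀⟶∃¬ s _ (λ k → Fin.any? (λ r → W≤0? r k)) ¬zeros =
    positive-column⇒¬MonotoneSteps W W≥0 3+M≤s k (λ r Wrk≤0 → ¬zero (r , Wrk≤0)) steps
    where
    3+M≤s : suc (suc (suc M)) ≤ s
    3+M≤s = ℕ.≤-trans (s≤s (n≤n! (suc (suc M)))) M!<s
  ... | yes zeros
    with r , crowded ← crowded-row W≤0? zeros (ℕ.≤-<-trans (ℕ.m≤n+m (suc M ℕ.* suc M !) (suc M !)) M!<s) =
    ¬MonotoneSteps W′ (λ _ _ → W≥0 _ _) (λ _ _ → W≤0? _ _) crowded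
      (MonotoneSteps-removeAt _ r row-r-vanishes (MonotoneSteps-thin W θ steps))
    where
    θ = select (W≤0? r)
    W′ = removeAt (λ r′ → W r′ ∘ embed θ) r
    row-r-vanishes : ∀ k → W r (embed θ k) ≈ 0#
    row-r-vanishes k = ≤ᶠ.antisym (select-sound (W≤0? r) k) (W≥0 r (embed θ k))

  homogenize : ∀ {m d} → (Fin m → Fin d → Carrier) → (Fin m → Carrier) → Fin m → Fin (suc d) → Carrier
  homogenize A b r = b r ∷ λ i → b r - A r i

  homogenize-∙ : ∀ {m d} (A : Fin m → Fin d → Carrier) b r (u : Vector Carrier (suc d)) →
                 homogenize A b r ∙ u ≈ b r * Σᶠ.sum u - A r ∙ (u ∘ suc)
  homogenize-∙ A b r u = begin
    b r * u zero + Σᶠ.sum (λ i → (b r - A r i) * u (suc i))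
      ≈⟨ +-congˡ (Σᶠ.sum-cong-≋ (λ i → [y-z]x≈yx-zx (u (suc i)) (b r) (A r i))) ⟩
    b r * u zero + Σᶠ.sum (λ i → b r * u (suc i) - A r i * u (suc i))
      ≈⟨ +-congˡ (sum-sub (λ i → b r * u (suc i)) (λ i → A r i * u (suc i))) ⟩
    b r * u zero + (Σᶠ.sum (λ i → b r * u (suc i)) - A r ∙ (u ∘ suc))
      ≈⟨ +-congˡ (+-congʳ (*-distribˡ-sum (b r) (u ∘ suc))) ⟨
    b r * u zero + (b r * Σᶠ.sum (u ∘ suc) - A r ∙ (u ∘ suc))
      ≈⟨ +-assoc _ _ _ ⟨
    b r * u zero + b r * Σᶠ.sum (u ∘ suc) - A r ∙ (u ∘ suc)
      ≈⟨ +-congʳ (distribˡ (b r) (u zero) _) ⟨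
    b r * Σᶠ.sum u - A r ∙ (u ∘ suc)
      ∎
    where open ≈-Reasoning

  satisfies-ℕ : ∀ {d} {a : Vector Carrier d} {c x} (p : Fin d → ℕ) → (∀ i → x i ≡ ℤ.+ p i) →
                Satisfies a c x → a ∙ ⟦ p ⟧ ≤ᶠ c
  satisfies-ℕ {a = a} {x = x} p x≡p = ≤ᶠ.≤-respˡ-≈ (reflexive (begin
    sumFin (λ i → a i * fromℤ (x i))  ≡⟨ sumFin≡sum (λ i → a i * fromℤ (x i)) ⟩
    Σᶠ.sum (λ i → a i * fromℤ (x i))  ≡⟨ Σᶠ.sum-cong-≗ (λ i → cong (λ t → a i * fromℤ t) (x≡p i)) ⟩
    a ∙ ⟦ p ⟧                         ∎))
    where open ≡-Reasoning

  homogenize-nonNeg : ∀ {m d} {A : Fin m → Fin d → Carrier} {b} →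
                      IsRelaxation A b (InΔ d) → NonNeg (homogenize A b)
  homogenize-nonNeg {A = A} rel r zero    = ≤ᶠ.≤-respˡ-≈ (∙-zeroʳ (A r))
    (satisfies-ℕ {a = A r} (λ _ → 0) (λ _ → refl) (proj₂ (rel _) (inj₁ (λ _ → refl)) r))
  homogenize-nonNeg {A = A} rel r (suc j) = x≤y⇒0≤y-x (≤ᶠ.≤-respˡ-≈ (∙-unit (A r) j)
    (satisfies-ℕ {a = A r} (unitℕ j) (unit≡+unitℕ j) (proj₂ (rel _) (inj₂ (j , λ _ → refl)) r)))

  dominance⇒Satisfies : ∀ {m d} (A : Fin m → Fin d → Carrier) b (p q : Fin (suc d) → ℕ) → sum p ≡ suc (sum q) →
                        (∀ r → homogenize A b r ∙ ⟦ q ⟧ ≤ᶠ homogenize A b r ∙ ⟦ p ⟧) →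
                        ∀ r → Satisfies (A r) (b r) (λ i → p (suc i) ⊖ q (suc i))
  dominance⇒Satisfies A b p q Σp≡1+Σq q≤ᵂp r = ≤ᶠ.≤-respˡ-≈ (≈-sym lhs≈Az′) (0≤y-x⇒x≤y 0≤b-Az′)
    where
    z : Vector Carrier _
    z k = fromℕ (p k) - fromℕ (q k)
    Σz≈1 : Σᶠ.sum z ≈ 1#
    Σz≈1 = begin
      Σᶠ.sum z                                ≈⟨ sum-sub ⟦ p ⟧ ⟦ q ⟧ ⟩
      Σᶠ.sum ⟦ p ⟧ - Σᶠ.sum ⟦ q ⟧             ≈⟨ +-cong (sum-⟦⟧ p) (-‿cong (sum-⟦⟧ q)) ⟩
      fromℕ (sum p) - fromℕ (sum q)           ≡⟨ cong (λ n → fromℕ n - fromℕ (sum q)) Σp≡1+Σq ⟩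
      1# + fromℕ (sum q) - fromℕ (sum q)      ≈⟨ +-assoc 1# _ _ ⟩
      1# + (fromℕ (sum q) - fromℕ (sum q))    ≈⟨ +-congˡ (-‿inverseʳ _) ⟩
      1# + 0#                                 ≈⟨ +-identityʳ 1# ⟩
      1#                                      ∎
      where open ≈-Reasoning
    lhs≈Az′ : sumFin (λ i → A r i * fromℤ (p (suc i) ⊖ q (suc i))) ≈ A r ∙ (z ∘ suc)
    lhs≈Az′ = ≈-trans (reflexive (sumFin≡sum (λ i → A r i * fromℤ (p (suc i) ⊖ q (suc i)))))
                      (∙-congˡ (A r) (λ i → fromℤ-⊖ (p (suc i)) (q (suc i))))
    0≤b-Az′ : 0# ≤ᶠ b r - A r ∙ (z ∘ suc)
    0≤b-Az′ = begin
      0#                                                    ≤⟨ x≤y⇒0≤y-x (q≤ᵂp r) ⟩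
      homogenize A b r ∙ ⟦ p ⟧ - homogenize A b r ∙ ⟦ q ⟧   ≈⟨ ∙-distrib-- (homogenize A b r) ⟦ p ⟧ ⟦ q ⟧ ⟨
      homogenize A b r ∙ z                                  ≈⟨ homogenize-∙ A b r z ⟩
      b r * Σᶠ.sum z - A r ∙ (z ∘ suc)                      ≈⟨ +-congʳ (≈-trans (*-congˡ Σz≈1) (*-identityʳ (b r))) ⟩
      b r - A r ∙ (z ∘ suc)                                 ∎
      where open ≤ᶠ-Reasoning

  homogenize-MonotoneSteps : ∀ {m d} {A : Fin m → Fin d → Carrier} {b} →
                             IsRelaxation A b (InΔ d) → MonotoneSteps (homogenize A b)
  homogenize-MonotoneSteps {A = A} {b} rel p q Σp≡1+Σq q≤ᵂp
    with q′≤p′ , Σp′≤1+Σq′ ← InΔ-difference (p ∘ suc) (q ∘ suc)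
                               (proj₁ (rel _) (dominance⇒Satisfies A b p q Σp≡1+Σq q≤ᵂp))
    = λ where
        zero    → m+n≡1+o+p⇒n≤1+p⇒o≤m Σp≡1+Σq Σp′≤1+Σq′
        (suc i) → q′≤p′ i

proposition10 : (k : ℕ) → 1 ≤ k → (F : ArchOrderedField) → (m : ℕ)
    → (A : Fin m → Fin (k !) → ArchOrderedField.Carrier F)
    → (b : Fin m → ArchOrderedField.Carrier F)
    → ArchOrderedField.IsRelaxation F A b (InΔ (k !))
    → k ≤ m
proposition10 k _ F m A b rel = ℕ.≮⇒≥ λ m<k →
  ¬¬-Π-Fin (λ r → ¬¬-Π-Fin (λ i → ¬¬-excluded-middle)) λ W≤0? →
    ¬MonotoneSteps F (homogenize F A b) (homogenize-nonNeg F rel) W≤0? (s≤s (!-mono-≤ m<k))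
                   (homogenize-MonotoneSteps F rel)
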